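{- Let $(X,\wedge,\vee,\bot,\top)$ be a bounded distributive lattice, let $n\ge 1$, and let $x=(x_1,\ldots,x_n)$ be a sequence in $X$ such that $x_i\le x_n$ for all $1\le i\le n-1$. For $1\le k\le m\le n$ define \[ S_x(m,k)=\bigwedge_{I\subseteq\{1,\ldots,m\},\ |I|=k}\ \bigvee_{i\in I} x_i . \] Then $S_x(n,n)=x_n$, and $S_x(n,i)=S_x(n-1,i)$ for all $1\le i\le n-1$.
   Context: $\le$ is the partial order of the lattice. $S_x(m,k)$ is the $k$-th entry of the sequence $(x_1,\ldots,x_m)$ "sorted with respect to the lattice", defined by the displayed meet over all $k$-element subsets $I$ of $\{1,\ldots,m\}$. -}

module Defs where

open import Level using (Level; suc; _⊔_)
open import Data.Nat as ℕ using (ℕ; zero)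
open import Data.Fin using (Fin)
import Data.Fin as F
open import Data.Fin.Subset using (Subset; inside; outside; ∣_∣)
open import Data.List using (List; []; _∷_; _++_; map; filter; foldr)
open import Data.Vec using (Vec; []; _∷_)
open import Relation.Binary.PropositionalEquality using (_≡_)
open import Algebra.Lattice.Bundles using (DistributiveLattice)

record BoundedDistributiveLattice c ℓ : Set (suc (c ⊔ ℓ)) where
  field
    distributiveLattice : DistributiveLattice c ℓ
  open DistributiveLattice distributiveLattice public
  field
    ⊥ : Carrier
    ⊤ : Carrier
    ∨-identityˡ : ∀ x → (⊥ ∨ x) ≈ x
    ∧-identityˡ : ∀ x → (⊤ ∧ x) ≈ x

  _≤_ : Carrier → Carrier → Set ℓ
  x ≤ y = (x ∧ y) ≈ x

allSubsets : (m : ℕ) → List (Subset m)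
allSubsets zero = [] ∷ []
allSubsets (ℕ.suc m) = map (inside ∷_) (allSubsets m) ++ map (outside ∷_) (allSubsets m)

subsetsOfSize : (m k : ℕ) → List (Subset m)
subsetsOfSize m k = filter (λ p → ∣ p ∣ ℕ.≟ k) (allSubsets m)

module _ {c ℓ} (L : BoundedDistributiveLattice c ℓ) where
  open BoundedDistributiveLattice L

  joinOver : ∀ {m} → (Fin m → Carrier) → Subset m → Carrier
  joinOver y [] = ⊥
  joinOver y (inside ∷ p) = y F.zero ∨ joinOver (λ i → y (F.suc i)) p
  joinOver y (outside ∷ p) = joinOver (λ i → y (F.suc i)) p

  meetList : List Carrier → Carrier
  meetList = foldr _∧_ ⊤

  S : (m : ℕ) → (Fin m → Carrier) → (k : ℕ) → Carrier
  S m y k = meetList (map (joinOver y) (subsetsOfSize m k))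

-- Since x_n dominates x_1,…,x_{n-1}, the join over any index set containing
-- n is x_n. The only n-subset is {1,…,n}, so S(n,n) = x_n. For i ≤ n-1 an
-- i-subset of {1,…,n} either avoids n, and these are exactly the i-subsets of
-- {1,…,n-1}, or contains n and contributes x_n to the meet, which is
-- redundant because S(n-1,i) ≤ x_n.
module Submission where

open import Defs
open import Level using (Level)
open import Data.Nat using (ℕ; zero; suc; _≤_; z≤n; s≤s; _≟_)
open import Data.Fin using (Fin; inject₁; fromℕ)
import Data.Fin as Fin
open import Data.Product using (_×_; ∃; _,_; proj₂)
open import Data.List using (List; []; _∷_; map)
open import Data.List.Membership.Propositional using (_∈_)
open import Data.List.Membership.Propositional.Properties
  using (∈-map⁺; ∈-++⁺ˡ; ∈-++⁺ʳ; ∈-filter⁺; ∈-filter⁻)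
open import Data.List.Relation.Unary.Any using (here; there)
open import Data.Vec using ([]; _∷_; _∷ʳ_; initLast)
open import Data.Fin.Subset using (Subset; inside; outside; ∣_∣)
import Data.Fin.Subset as Subset
open import Data.Fin.Subset.Properties using (∣⊥∣≡0; ∣⊤∣≡n; ∣p∣≡n⇒p≡⊤)
open import Function using (_∘_)
open import Relation.Binary.Definitions using (Minimum; Maximum)
open import Relation.Binary.PropositionalEquality using (_≡_; refl; cong; trans)
import Relation.Binary.PropositionalEquality as ≡

∈-allSubsets : ∀ {m} (p : Subset m) → p ∈ allSubsets m
∈-allSubsets []            = here refl
∈-allSubsets (inside ∷ p)  = ∈-++⁺ˡ (∈-map⁺ (inside ∷_) (∈-allSubsets p))
∈-allSubsets {suc m} (outside ∷ p) =
  ∈-++⁺ʳ (map (inside ∷_) (allSubsets m)) (∈-map⁺ (outside ∷_) (∈-allSubsets p))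

∈-subsetsOfSize⁺ : ∀ {m k} {p : Subset m} → ∣ p ∣ ≡ k → p ∈ subsetsOfSize m k
∈-subsetsOfSize⁺ {k = k} {p} = ∈-filter⁺ (λ p → ∣ p ∣ ≟ k) (∈-allSubsets p)

∈-subsetsOfSize⁻ : ∀ {m k} {p : Subset m} → p ∈ subsetsOfSize m k → ∣ p ∣ ≡ k
∈-subsetsOfSize⁻ {m} {k} p∈ = proj₂
  (∈-filter⁻ (λ p → ∣ p ∣ ≟ k) {xs = allSubsets m} p∈)

subset-of-size : ∀ {m k} → k ≤ m → ∃ λ (p : Subset m) → ∣ p ∣ ≡ k
subset-of-size {m} z≤n = Subset.⊥ , ∣⊥∣≡0 m
subset-of-size (s≤s k≤m) with subset-of-size k≤m
... | p , ∣p∣≡k = inside ∷ p , cong suc ∣p∣≡k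

∣p∷ʳoutside∣≡∣p∣ : ∀ {n} (p : Subset n) → ∣ p ∷ʳ outside ∣ ≡ ∣ p ∣
∣p∷ʳoutside∣≡∣p∣ []            = refl
∣p∷ʳoutside∣≡∣p∣ (inside ∷ p)  = cong suc (∣p∷ʳoutside∣≡∣p∣ p)
∣p∷ʳoutside∣≡∣p∣ (outside ∷ p) = ∣p∷ʳoutside∣≡∣p∣ p

⊤≡⊤∷ʳinside : ∀ n → Subset.⊤ {suc n} ≡ Subset.⊤ {n} ∷ʳ inside
⊤≡⊤∷ʳinside zero    = refl
⊤≡⊤∷ʳinside (suc n) = cong (inside ∷_) (⊤≡⊤∷ʳinside n)

module _ {c ℓ} (L : BoundedDistributiveLattice c ℓ) where
  open BoundedDistributiveLattice L
    using (Carrier; _≈_; _∧_; _∨_; ⊥; ⊤; ∨-congˡ; ∨-comm; ∨-assoc;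
           ∧-congˡ; ∧-comm; ∧-absorbs-∨; ∨-identityˡ; ∧-identityˡ; lattice; setoid)
    renaming (refl to ≈-refl; sym to ≈-sym; trans to ≈-trans)
  open import Algebra.Lattice.Properties.Lattice lattice using (∨-∧-orderTheoreticLattice)
  open import Relation.Binary.Lattice.Bundles using (module Lattice)

  open Lattice ∨-∧-orderTheoreticLattice
    using (joinSemilattice; antisym; y≤x∨y; ∨-least;
           x∧y≤x; x∧y≤y; ∧-greatest; ≤-respʳ-≈)
    renaming (_≤_ to _⊑_; refl to ⊑-refl; trans to ⊑-trans)
  open import Relation.Binary.Lattice.Properties.JoinSemilattice joinSemilattice
    using (x≤y⇒x∨y≈y)

  -- _⊑_ is x ≈ x ∧ y, the symmetric form of BoundedDistributiveLattice._≤_.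
  ≤⇒⊑ : ∀ {a b} → BoundedDistributiveLattice._≤_ L a b → a ⊑ b
  ≤⇒⊑ = ≈-sym

  ⊥-minimum : Minimum _⊑_ ⊥
  ⊥-minimum z = ≈-sym (≈-trans (∧-congˡ (≈-sym (∨-identityˡ z))) (∧-absorbs-∨ ⊥ z))

  ⊤-maximum : Maximum _⊑_ ⊤
  ⊤-maximum z = ≈-sym (≈-trans (∧-comm z ⊤) (∧-identityˡ z))

  meetList-lowerBound : ∀ {A : Set} (f : A → Carrier) {a} {as : List A} →
                        a ∈ as → meetList L (map f as) ⊑ f a
  meetList-lowerBound f (here refl) = x∧y≤x _ _
  meetList-lowerBound f (there a∈) = ⊑-trans (x∧y≤y _ _) (meetList-lowerBound f a∈)

  meetList-greatest : ∀ {A : Set} (f : A → Carrier) {z} (as : List A) →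
                      (∀ {a} → a ∈ as → z ⊑ f a) → z ⊑ meetList L (map f as)
  meetList-greatest f []       z⊑ = ⊤-maximum _
  meetList-greatest f (a ∷ as) z⊑ = ∧-greatest (z⊑ (here refl)) (meetList-greatest f as (z⊑ ∘ there))

  joinOver-least : ∀ {m} (y : Fin m → Carrier) {a} → (∀ j → y j ⊑ a) →
                   ∀ p → joinOver L y p ⊑ a
  joinOver-least y y⊑a []            = ⊥-minimum _
  joinOver-least y y⊑a (inside ∷ p)  =
    ∨-least (y⊑a Fin.zero) (joinOver-least (y ∘ Fin.suc) (y⊑a ∘ Fin.suc) p)
  joinOver-least y y⊑a (outside ∷ p) = joinOver-least (y ∘ Fin.suc) (y⊑a ∘ Fin.suc) p

  joinOver-∷ʳ-outside : ∀ {n} (y : Fin (suc n) → Carrier) (p : Subset n) →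
                        joinOver L y (p ∷ʳ outside) ≈ joinOver L (y ∘ inject₁) p
  joinOver-∷ʳ-outside y []            = ≈-refl
  joinOver-∷ʳ-outside y (inside ∷ p)  = ∨-congˡ (joinOver-∷ʳ-outside (y ∘ Fin.suc) p)
  joinOver-∷ʳ-outside y (outside ∷ p) = joinOver-∷ʳ-outside (y ∘ Fin.suc) p

  joinOver-∷ʳ-inside : ∀ {n} (y : Fin (suc n) → Carrier) (p : Subset n) →
                       joinOver L y (p ∷ʳ inside) ≈ joinOver L (y ∘ inject₁) p ∨ y (fromℕ n)
  joinOver-∷ʳ-inside y []            = ∨-comm _ _
  joinOver-∷ʳ-inside y (inside ∷ p)  =
    ≈-trans (∨-congˡ (joinOver-∷ʳ-inside (y ∘ Fin.suc) p)) (≈-sym (∨-assoc _ _ _))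
  joinOver-∷ʳ-inside y (outside ∷ p) = joinOver-∷ʳ-inside (y ∘ Fin.suc) p

  S-lowerBound : ∀ {m} (y : Fin m → Carrier) {k} (p : Subset m) →
                 ∣ p ∣ ≡ k → S L m y k ⊑ joinOver L y p
  S-lowerBound y p ∣p∣≡k = meetList-lowerBound (joinOver L y) (∈-subsetsOfSize⁺ {p = p} ∣p∣≡k)

  S-greatest : ∀ {m} (y : Fin m → Carrier) k {z} →
               (∀ p → ∣ p ∣ ≡ k → z ⊑ joinOver L y p) → z ⊑ S L m y k
  S-greatest {m} y k z⊑ = meetList-greatest (joinOver L y) (subsetsOfSize m k)
    (λ {p} p∈ → z⊑ p (∈-subsetsOfSize⁻ p∈))

  S-⊑-bound : ∀ {m} (y : Fin m → Carrier) {k a} → k ≤ m → (∀ j → y j ⊑ a) → S L m y k ⊑ a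
  S-⊑-bound y k≤m y⊑a with subset-of-size k≤m
  ... | p , ∣p∣≡k = ⊑-trans (S-lowerBound y p ∣p∣≡k) (joinOver-least y y⊑a p)

  S-full : ∀ m (y : Fin m → Carrier) → S L m y m ≈ joinOver L y Subset.⊤
  S-full m y = antisym (S-lowerBound y Subset.⊤ (∣⊤∣≡n m)) (S-greatest y m ⊤-least)
    where
    ⊤-least : ∀ p → ∣ p ∣ ≡ m → joinOver L y Subset.⊤ ⊑ joinOver L y p
    ⊤-least p ∣p∣≡m rewrite ∣p∣≡n⇒p≡⊤ {p = p} ∣p∣≡m = ⊑-refl

  module _ {n} (x : Fin (suc n) → Carrier) (x⊑last : ∀ i → x (inject₁ i) ⊑ x (fromℕ n)) where

    S-full-of-last-maximum : S L (suc n) x (suc n) ≈ x (fromℕ n)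
    S-full-of-last-maximum = begin
      S L (suc n) x (suc n)                        ≈⟨ S-full (suc n) x ⟩
      joinOver L x Subset.⊤                        ≡⟨ cong (joinOver L x) (⊤≡⊤∷ʳinside n) ⟩
      joinOver L x (Subset.⊤ ∷ʳ inside)            ≈⟨ joinOver-∷ʳ-inside x Subset.⊤ ⟩
      joinOver L (x ∘ inject₁) Subset.⊤ ∨ x (fromℕ n)
        ≈⟨ x≤y⇒x∨y≈y (joinOver-least (x ∘ inject₁) x⊑last Subset.⊤) ⟩
      x (fromℕ n)                                  ∎
      where open import Relation.Binary.Reasoning.Setoid setoid

    S-init-of-last-maximum : ∀ {k} → k ≤ n → S L (suc n) x k ≈ S L n (x ∘ inject₁) k
    S-init-of-last-maximum {k} k≤n =
      antisym (S-greatest (x ∘ inject₁) k extension-⊑) (S-greatest x k init-⊑)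
      where
      extension-⊑ : ∀ q → ∣ q ∣ ≡ k → S L (suc n) x k ⊑ joinOver L (x ∘ inject₁) q
      extension-⊑ q ∣q∣≡k = ≤-respʳ-≈ (joinOver-∷ʳ-outside x q)
        (S-lowerBound x (q ∷ʳ outside) (trans (∣p∷ʳoutside∣≡∣p∣ q) ∣q∣≡k))

      init-⊑ : ∀ p → ∣ p ∣ ≡ k → S L n (x ∘ inject₁) k ⊑ joinOver L x p
      init-⊑ p ∣p∣≡k with initLast p
      ... | q , inside , refl = ≤-respʳ-≈ (≈-sym (joinOver-∷ʳ-inside x q))
        (⊑-trans (S-⊑-bound (x ∘ inject₁) k≤n x⊑last) (y≤x∨y _ _))
      ... | q , outside , refl = ≤-respʳ-≈ (≈-sym (joinOver-∷ʳ-outside x q))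
        (S-lowerBound (x ∘ inject₁) q (trans (≡.sym (∣p∷ʳoutside∣≡∣p∣ q)) ∣p∣≡k))

lemma3p3 : {c ℓ : Level} (L : BoundedDistributiveLattice c ℓ) (n : ℕ)
    → (x : Fin (suc n) → BoundedDistributiveLattice.Carrier L)
    → (∀ (i : Fin n) → BoundedDistributiveLattice._≤_ L (x (inject₁ i)) (x (fromℕ n)))
    → BoundedDistributiveLattice._≈_ L (S L (suc n) x (suc n)) (x (fromℕ n))
      × (∀ (i : ℕ) → 1 ≤ i → i ≤ n
          → BoundedDistributiveLattice._≈_ L (S L (suc n) x i) (S L n (λ j → x (inject₁ j)) i))
lemma3p3 L n x x≤last =
    S-full-of-last-maximum L x (≤⇒⊑ L ∘ x≤last)
  , λ i _ i≤n → S-init-of-last-maximum L x (≤⇒⊑ L ∘ x≤last) i≤n
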